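{- Let $\chi:\bar\Gamma_0(2)\to\mathbf{C}^\times$ be a character with $\chi(\bar U)$ a primitive $n$-th root of unity and $\chi(\bar V)=\varepsilon\in\{\pm1\}$; put $H_0=\ker\chi\cap\bar\Gamma(2)$ and $H_1=H_0\langle\bar V\rangle$. Then: (i) $|\bar\Gamma(2):H_0|=|\bar\Gamma_0(2):H_1|=n$; (ii) $\bar\Gamma(2)=H_0\langle\bar U\rangle=H_0\langle\bar T\bar U\bar T^{ -1}\rangle$; (iii) $|\bar\Gamma(2):H_0\langle\bar T^2\rangle|\le 2$, with equality if and only if $n$ is even.
   Context: $\Gamma=\mathrm{PSL}_2(\mathbf{Z})$; bars denote images in $\Gamma$; $T=\begin{pmatrix}1&1\\0&1\end{pmatrix}$, $U=\begin{pmatrix}1&0\\2&1\end{pmatrix}$, $V=TU^{ -1}=\begin{pmatrix}-1&1\\-2&1\end{pmatrix}$. -}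

module Defs where

open import Level using (Level; _⊔_; 0ℓ)
open import Data.Integer as ℤ using (ℤ; +_; -[1+_]; _+_; _*_; -_; _-_)
open import Data.Integer.Divisibility using (_∣_; divides)
open import Data.Nat as ℕ using (ℕ; zero; suc)
open import Data.Fin using (Fin)
open import Data.Product using (Σ; ∃; _×_; _,_)
open import Data.Sum using (_⊎_)
open import Relation.Binary.PropositionalEquality using (_≡_; refl)
open import Relation.Nullary using (¬_)
open import Algebra.Bundles using (AbelianGroup)

-- Integer 2x2 matrices.  PSL₂(ℤ) = {M | det M = 1} modulo M ~ -M.

record Mat : Set where
  constructor mat
  field
    a b c d : ℤ
open Mat public

det : Mat → ℤ
det M = a M * d M - b M * c M

infixl 7 _·_
_·_ : Mat → Mat → Mat
M · N = mat (a M * a N + b M * c N) (a M * b N + b M * d N)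
            (c M * a N + d M * c N) (c M * b N + d M * d N)

I : Mat
I = mat (+ 1) (+ 0) (+ 0) (+ 1)

-- inverse of a determinant-one matrix (adjugate)
inv : Mat → Mat
inv M = mat (d M) (- b M) (- c M) (a M)

neg : Mat → Mat
neg M = mat (- a M) (- b M) (- c M) (- d M)

infix 4 _≈P_
_≈P_ : Mat → Mat → Set
M ≈P N = M ≡ N ⊎ M ≡ neg N

powℕ : Mat → ℕ → Mat
powℕ M zero = I
powℕ M (suc k) = M · powℕ M k

pow : Mat → ℤ → Mat
pow M (+ k) = powℕ M k
pow M -[1+ k ] = powℕ (inv M) (suc k)

T U V : Mat
T = mat (+ 1) (+ 1) (+ 0) (+ 1)
U = mat (+ 1) (+ 0) (+ 2) (+ 1)
V = T · inv U

Γ₀2 : Mat → Set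
Γ₀2 M = (det M ≡ + 1) × ((+ 2) ∣ c M)

Γ2 : Mat → Set
Γ2 M = (det M ≡ + 1) × ((+ 2) ∣ b M) × ((+ 2) ∣ c M)

Γ2⇒Γ₀2 : ∀ {M} → Γ2 M → Γ₀2 M
Γ2⇒Γ₀2 (p , _ , q) = p , q

U∈Γ₀2 : Γ₀2 U
U∈Γ₀2 = refl , divides 1 refl

V∈Γ₀2 : Γ₀2 V
V∈Γ₀2 = refl , divides 1 refl

-- H⟨g⟩ = { h g^k | h ∈ H, k ∈ ℤ } (up to ±)

Join : ∀ {ℓ} → (Mat → Set ℓ) → Mat → Mat → Set ℓ
Join H g M = ∃ λ h → ∃ λ (k : ℤ) → H h × (M ≈P h · pow g k)

-- |G : H| = n : there are n representatives g₁..gₙ ∈ G whose left cosets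
-- gᵢH are pairwise distinct and cover G.
record Index {p q : Level} (G : Mat → Set p) (H : Mat → Set q) (n : ℕ)
       : Set (p ⊔ q) where
  field
    rep      : Fin n → Mat
    rep∈G    : ∀ i → G (rep i)
    distinct : ∀ i j → H (inv (rep i) · rep j) → i ≡ j
    cover    : ∀ x → G x → ∃ λ i → H (inv (rep i) · x)

-- Characters of Γ̄₀(2) with values in an abelian group A
-- (C^× generalised to an arbitrary abelian group)

module _ {c ℓ : Level} (A : AbelianGroup c ℓ) where
  open AbelianGroup A renaming (Carrier to ∣A∣)

  record Character : Set (c ⊔ ℓ) where
    field
      χ    : (M : Mat) → Γ₀2 M → ∣A∣
      resp : ∀ {M N} (p : Γ₀2 M) (q : Γ₀2 N) → M ≈P N → χ M p ≈ χ N q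
      hom  : ∀ {M N} (p : Γ₀2 M) (q : Γ₀2 N) (r : Γ₀2 (M · N)) →
             χ (M · N) r ≈ (χ M p ∙ χ N q)

  powA : ∣A∣ → ℕ → ∣A∣
  powA x zero = ε
  powA x (suc k) = x ∙ powA x k

  IsPrimitiveRoot : ∣A∣ → ℕ → Set ℓ
  IsPrimitiveRoot x n =
    (1 ℕ.≤ n) × (powA x n ≈ ε) × (∀ k → 1 ℕ.≤ k → k ℕ.< n → ¬ (powA x k ≈ ε))

  H0 : Character → Mat → Set ℓ
  H0 X M = Σ (Γ2 M) λ p → Character.χ X M (Γ2⇒Γ₀2 {M} p) ≈ ε

module Submission where

-- Γ̄(2) is generated by T̄² and Ū: for M = (a b; c d) in Γ(2), a is odd and c is even, so
-- unless c = 0 one of T^{∓2}M, U^{∓1}M has a smaller |a| + |c|, and when c = 0 the matrix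
-- is ±T^{2q}. Since T = VU and χ(V̄)² = χ(V̄²) = 1, χ(T̄²) = ζ², so χ maps Γ̄(2) onto the
-- cyclic group ⟨ζ⟩ of order n, with kernel H₀. Hence, for g ∈ Γ̄(2), H₀⟨g⟩ is the part of
-- Γ̄(2) that χ maps into ⟨χ(g)⟩, and for d ∣ n the preimage of ⟨ζᵈ⟩ has the d cosets of
-- Ū^i, i < d (the exponent of χ is read modulo d). This gives (i) for H₀ (d = n), (ii)
-- because χ(Ū) = χ(T̄ŪT̄⁻¹) = ζ, and (iii) because ⟨ζ²⟩ is ⟨ζ⟩ for odd n and of index 2
-- for even n. Finally Γ̄₀(2) = Γ̄(2) ∪ Γ̄(2)V̄ with V̄² = 1 and V̄ ∉ Γ̄(2), so the same
-- representatives serve for H₁ = H₀⟨V̄⟩ in Γ̄₀(2).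

open import Defs
open import Level using (Level)
open import Data.Nat as ℕ using (ℕ; zero; suc; z≤n; s≤s; _<_; _≤_; _%_; _/_; NonZero)
import Data.Nat.Properties as ℕₚ
open import Data.Nat.Divisibility as ℕ∣ using (_∣_; _∣?_; ∣-refl; 1∣_)
open import Data.Nat.DivMod using (m≡m%n+[m/n]*n; m%n<n; m<n⇒m%n≡m; [m+kn]%n≡m%n; m∣n⇒o%n%m≡o%m)
open import Data.Fin as Fin using (Fin; toℕ; fromℕ<)
open import Data.Fin.Properties using (toℕ<n; toℕ-injective; toℕ-fromℕ<)
open import Data.Integer as ℤ using (ℤ; +_; -[1+_]; _+_; _*_; -_; _-_; ∣_∣)
import Data.Integer.Properties as ℤₚ
import Data.Integer.DivMod as ℤ÷
import Data.Integer.Divisibility as ℤ∣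
import Data.Integer.Divisibility.Signed as ℤ∣ˢ
open import Data.Integer.Tactic.RingSolver using (solve-∀)
open import Data.Product using (∃; Σ; _×_; _,_; proj₁; proj₂)
open import Data.Sum as Sum using (_⊎_; inj₁; inj₂)
open import Data.Empty using (⊥; ⊥-elim)
open import Relation.Nullary using (¬_; yes; no)
open import Relation.Binary using (tri<; tri≈; tri>)
open import Relation.Binary.PropositionalEquality
  using (_≡_; refl; sym; trans; cong; cong₂; subst; module ≡-Reasoning)
open import Function.Bundles using (_⇔_; mk⇔; Equivalence)
open import Algebra.Bundles using (AbelianGroup)

mat-cong : ∀ {a b c d a′ b′ c′ d′} → a ≡ a′ → b ≡ b′ → c ≡ c′ → d ≡ d′ →
           mat a b c d ≡ mat a′ b′ c′ d′
mat-cong refl refl refl refl = refl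

·-assoc : ∀ M N P → (M · N) · P ≡ M · (N · P)
·-assoc (mat a₁ b₁ c₁ d₁) (mat a₂ b₂ c₂ d₂) (mat a₃ b₃ c₃ d₃) =
  mat-cong (entry a₁ b₁ a₂ b₂ c₂ d₂ a₃ c₃) (entry a₁ b₁ a₂ b₂ c₂ d₂ b₃ d₃)
           (entry c₁ d₁ a₂ b₂ c₂ d₂ a₃ c₃) (entry c₁ d₁ a₂ b₂ c₂ d₂ b₃ d₃)
  where
  entry : ∀ x y a b c d z w → (x * a + y * c) * z + (x * b + y * d) * w ≡
                              x * (a * z + b * w) + y * (c * z + d * w)
  entry = solve-∀

·-identityˡ : ∀ M → I · M ≡ M
·-identityˡ (mat a b c d) = mat-cong (entry a c) (entry b d) (entry′ a c) (entry′ b d)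
  where
  entry : ∀ x y → + 1 * x + + 0 * y ≡ x
  entry = solve-∀
  entry′ : ∀ x y → + 0 * x + + 1 * y ≡ y
  entry′ = solve-∀

·-identityʳ : ∀ M → M · I ≡ M
·-identityʳ (mat a b c d) = mat-cong (entry a b) (entry′ a b) (entry c d) (entry′ c d)
  where
  entry : ∀ x y → x * + 1 + y * + 0 ≡ x
  entry = solve-∀
  entry′ : ∀ x y → x * + 0 + y * + 1 ≡ y
  entry′ = solve-∀

det-· : ∀ M N → det (M · N) ≡ det M * det N
det-· (mat a₁ b₁ c₁ d₁) (mat a₂ b₂ c₂ d₂) = identity a₁ b₁ c₁ d₁ a₂ b₂ c₂ d₂
  where
  identity : ∀ a₁ b₁ c₁ d₁ a₂ b₂ c₂ d₂ →
    (a₁ * a₂ + b₁ * c₂) * (c₁ * b₂ + d₁ * d₂) - (a₁ * b₂ + b₁ * d₂) * (c₁ * a₂ + d₁ * c₂)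
    ≡ (a₁ * d₁ - b₁ * c₁) * (a₂ * d₂ - b₂ * c₂)
  identity = solve-∀

det-inv : ∀ M → det (inv M) ≡ det M
det-inv (mat a b c d) = identity a b c d
  where
  identity : ∀ a b c d → d * a - - b * - c ≡ a * d - b * c
  identity = solve-∀

det-neg : ∀ M → det (neg M) ≡ det M
det-neg (mat a b c d) = identity a b c d
  where
  identity : ∀ a b c d → - a * - d - - b * - c ≡ a * d - b * c
  identity = solve-∀

scalar : ℤ → Mat
scalar x = mat x (+ 0) (+ 0) x

inv-·-scalar : ∀ M → inv M · M ≡ scalar (det M)
inv-·-scalar (mat a b c d) = mat-cong (e₁ a b c d) (e₂ d b) (e₂′ c a) (e₃ a b c d)
  where
  e₁ : ∀ a b c d → d * a + - b * c ≡ a * d - b * c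
  e₁ = solve-∀
  e₂ : ∀ x y → x * y + - y * x ≡ + 0
  e₂ = solve-∀
  e₂′ : ∀ x y → - x * y + y * x ≡ + 0
  e₂′ = solve-∀
  e₃ : ∀ a b c d → - c * b + a * d ≡ a * d - b * c
  e₃ = solve-∀

·-inv-scalar : ∀ M → M · inv M ≡ scalar (det M)
·-inv-scalar (mat a b c d) = mat-cong (e₁ a b c d) (e₂ a b) (e₂′ c d) (e₃ a b c d)
  where
  e₁ : ∀ a b c d → a * d + b * - c ≡ a * d - b * c
  e₁ = solve-∀
  e₂ : ∀ x y → x * - y + y * x ≡ + 0
  e₂ = solve-∀
  e₂′ : ∀ x y → x * y + y * - x ≡ + 0
  e₂′ = solve-∀
  e₃ : ∀ a b c d → c * - b + d * a ≡ a * d - b * c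
  e₃ = solve-∀

inv-inverseˡ : ∀ {M} → det M ≡ + 1 → inv M · M ≡ I
inv-inverseˡ {M} det≡1 = trans (inv-·-scalar M) (cong scalar det≡1)

inv-inverseʳ : ∀ {M} → det M ≡ + 1 → M · inv M ≡ I
inv-inverseʳ {M} det≡1 = trans (·-inv-scalar M) (cong scalar det≡1)

·-neg : ∀ M N → M · neg N ≡ neg (M · N)
·-neg (mat a₁ b₁ c₁ d₁) (mat a₂ b₂ c₂ d₂) =
  mat-cong (entry a₁ b₁ a₂ c₂) (entry a₁ b₁ b₂ d₂) (entry c₁ d₁ a₂ c₂) (entry c₁ d₁ b₂ d₂)
  where
  entry : ∀ x y z w → x * - z + y * - w ≡ - (x * z + y * w)
  entry = solve-∀

neg-involutive : ∀ M → neg (neg M) ≡ M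
neg-involutive (mat a b c d) = mat-cong (ℤₚ.neg-involutive a) (ℤₚ.neg-involutive b)
                                        (ℤₚ.neg-involutive c) (ℤₚ.neg-involutive d)

module _ {g} (det≡1 : det g ≡ + 1) where
  open ≡-Reasoning

  inv-·-cancelˡ : ∀ M → inv g · (g · M) ≡ M
  inv-·-cancelˡ M = begin
    inv g · (g · M)  ≡⟨ ·-assoc (inv g) g M ⟨
    (inv g · g) · M  ≡⟨ cong (_· M) (inv-inverseˡ {g} det≡1) ⟩
    I · M            ≡⟨ ·-identityˡ M ⟩
    M                ∎

  ·-inv-cancelˡ : ∀ M → g · (inv g · M) ≡ M
  ·-inv-cancelˡ M = begin
    g · (inv g · M)  ≡⟨ ·-assoc g (inv g) M ⟨
    (g · inv g) · M  ≡⟨ cong (_· M) (inv-inverseʳ {g} det≡1) ⟩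
    I · M            ≡⟨ ·-identityˡ M ⟩
    M                ∎

  inv-·-cancelʳ : ∀ M → (M · inv g) · g ≡ M
  inv-·-cancelʳ M = begin
    (M · inv g) · g  ≡⟨ ·-assoc M (inv g) g ⟩
    M · (inv g · g)  ≡⟨ cong (M ·_) (inv-inverseˡ {g} det≡1) ⟩
    M · I            ≡⟨ ·-identityʳ M ⟩
    M                ∎

≈P-refl : ∀ {M} → M ≈P M
≈P-refl = inj₁ refl

≈P-sym : ∀ {M N} → M ≈P N → N ≈P M
≈P-sym (inj₁ refl) = inj₁ refl
≈P-sym (inj₂ refl) = inj₂ (sym (neg-involutive _))

≈P-trans : ∀ {M N P} → M ≈P N → N ≈P P → M ≈P P
≈P-trans (inj₁ refl) N≈P = N≈P
≈P-trans (inj₂ refl) (inj₁ refl) = inj₂ refl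
≈P-trans (inj₂ refl) (inj₂ refl) = inj₁ (neg-involutive _)

·-congˡ-≈P : ∀ g {M N} → M ≈P N → g · M ≈P g · N
·-congˡ-≈P g (inj₁ refl) = inj₁ refl
·-congˡ-≈P g {N = N} (inj₂ refl) = inj₂ (·-neg g N)

-- Defs states evenness with the unsigned divisibility of Data.Integer.Divisibility;
-- the closure lemmas below go through the signed one, which has the arithmetic API.
Even : ℤ → Set
Even z = + 2 ℤ∣.∣ z

even-+ : ∀ m n → Even m → Even n → Even (m + n)
even-+ m n 2∣m 2∣n =
  ℤ∣ˢ.∣⇒∣ᵤ {+ 2} {m + n} (ℤ∣ˢ.∣m∣n⇒∣m+n (ℤ∣ˢ.∣ᵤ⇒∣ {+ 2} {m} 2∣m) (ℤ∣ˢ.∣ᵤ⇒∣ {+ 2} {n} 2∣n))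

even-*ʳ : ∀ m n → Even m → Even (m * n)
even-*ʳ m n 2∣m = ℤ∣ˢ.∣⇒∣ᵤ {+ 2} {m * n} (ℤ∣ˢ.∣m⇒∣m*n n (ℤ∣ˢ.∣ᵤ⇒∣ {+ 2} {m} 2∣m))

even-*ˡ : ∀ m n → Even n → Even (m * n)
even-*ˡ m n 2∣n = ℤ∣ˢ.∣⇒∣ᵤ {+ 2} {m * n} (ℤ∣ˢ.∣n⇒∣m*n m (ℤ∣ˢ.∣ᵤ⇒∣ {+ 2} {n} 2∣n))

even-neg : ∀ m → Even m → Even (- m)
even-neg m = subst (2 ℕ∣.∣_) (sym (ℤₚ.∣-i∣≡∣i∣ m))

parity : ∀ z → Even z ⊎ ∃ λ q → z ≡ + 1 + q * + 2
parity z with z ℤ÷.%ℕ 2 | ℤ÷.n%ℕd<d z 2 | ℤ÷.a≡a%ℕn+[a/ℕn]*n z 2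
... | 0 | _ | z≡ = inj₁ (ℤ∣ˢ.∣⇒∣ᵤ (ℤ∣ˢ.divides (z ℤ÷./ℕ 2) (trans z≡ (ℤₚ.+-identityˡ _))))
... | 1 | _ | z≡ = inj₂ (z ℤ÷./ℕ 2 , z≡)
... | suc (suc _) | s≤s (s≤s ()) | _

odd-decomposition : ∀ m → ¬ 2 ∣ m → ∃ λ h → m ≡ suc (h ℕ.* 2)
odd-decomposition m 2∤m with m % 2 | m%n<n m 2 | m≡m%n+[m/n]*n m 2
... | 0 | _ | m≡2h = ⊥-elim (2∤m (ℕ∣.divides (m / 2) m≡2h))
... | 1 | _ | m≡1+2h = m / 2 , m≡1+2h
... | suc (suc _) | s≤s (s≤s ()) | _

det-·-one : ∀ {M N} → det M ≡ + 1 → det N ≡ + 1 → det (M · N) ≡ + 1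
det-·-one {M} {N} dM dN = trans (det-· M N) (cong₂ _*_ dM dN)

Γ₀2-I : Γ₀2 I
Γ₀2-I = refl , ℕ∣.divides 0 refl

Γ₀2-· : ∀ {M N} → Γ₀2 M → Γ₀2 N → Γ₀2 (M · N)
Γ₀2-· {M} {N} (dM , cM) (dN , cN) = det-·-one {M} {N} dM dN
  , even-+ (c M * a N) (d M * c N) (even-*ʳ (c M) (a N) cM) (even-*ˡ (d M) (c N) cN)

Γ₀2-inv : ∀ {M} → Γ₀2 M → Γ₀2 (inv M)
Γ₀2-inv {M} (dM , cM) = trans (det-inv M) dM , even-neg (c M) cM

Γ₀2-powℕ : ∀ {g} → Γ₀2 g → ∀ k → Γ₀2 (powℕ g k)
Γ₀2-powℕ pg zero = Γ₀2-I
Γ₀2-powℕ {g} pg (suc k) = Γ₀2-· {g} {powℕ g k} pg (Γ₀2-powℕ pg k)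

Γ2-I : Γ2 I
Γ2-I = refl , ℕ∣.divides 0 refl , ℕ∣.divides 0 refl

Γ2-· : ∀ {M N} → Γ2 M → Γ2 N → Γ2 (M · N)
Γ2-· {M} {N} (dM , bM , cM) (dN , bN , cN) =
  det-·-one {M} {N} dM dN ,
  even-+ (a M * b N) (b M * d N) (even-*ˡ (a M) (b N) bN) (even-*ʳ (b M) (d N) bM) ,
  even-+ (c M * a N) (d M * c N) (even-*ʳ (c M) (a N) cM) (even-*ˡ (d M) (c N) cN)

Γ2-inv : ∀ {M} → Γ2 M → Γ2 (inv M)
Γ2-inv {M} (dM , bM , cM) = trans (det-inv M) dM , even-neg (b M) bM , even-neg (c M) cM

Γ2-≈P : ∀ {M N} → M ≈P N → Γ2 N → Γ2 M
Γ2-≈P (inj₁ refl) pN = pN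
Γ2-≈P {N = N} (inj₂ refl) (dN , bN , cN) = trans (det-neg N) dN , even-neg (b N) bN , even-neg (c N) cN

Γ2-powℕ : ∀ {g} → Γ2 g → ∀ k → Γ2 (powℕ g k)
Γ2-powℕ pg zero = Γ2-I
Γ2-powℕ {g} pg (suc k) = Γ2-· {g} {powℕ g k} pg (Γ2-powℕ pg k)

Γ2-pow : ∀ {g} → Γ2 g → ∀ k → Γ2 (pow g k)
Γ2-pow {g} pg (+ k) = Γ2-powℕ {g} pg k
Γ2-pow {g} pg -[1+ k ] = Γ2-powℕ {inv g} (Γ2-inv {g} pg) (suc k)

¬Even-1 : ¬ Even (+ 1)
¬Even-1 2∣1 with ℕ∣.∣1⇒≡1 2∣1
... | ()

Γ₀2⇒a-odd : ∀ {M} → Γ₀2 M → ¬ Even (a M)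
Γ₀2⇒a-odd {M} (dM , cM) 2∣a = ¬Even-1 (subst Even dM (even-+ (a M * d M) (- (b M * c M))
  (even-*ʳ (a M) (d M) 2∣a) (even-neg (b M * c M) (even-*ˡ (b M) (c M) cM))))

V∉Γ2 : ¬ Γ2 V
V∉Γ2 (_ , 2∣1 , _) = ¬Even-1 2∣1

Γ₀2∧even-b⇒Γ2 : ∀ {M} → Γ₀2 M → Even (b M) → Γ2 M
Γ₀2∧even-b⇒Γ2 (det≡1 , 2∣c) 2∣b = det≡1 , 2∣b , 2∣c

Γ₀2⇒Γ2⊎Γ2·V : ∀ {M} → Γ₀2 M → Γ2 M ⊎ Γ2 (M · V)
Γ₀2⇒Γ2⊎Γ2·V {M} pM with parity (b M) | parity (a M)
... | inj₁ 2∣b | _ = inj₁ (Γ₀2∧even-b⇒Γ2 {M} pM 2∣b)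
... | inj₂ _ | inj₁ 2∣a = ⊥-elim (Γ₀2⇒a-odd {M} pM 2∣a)
... | inj₂ (q , b≡) | inj₂ (p , a≡) = inj₂ (Γ₀2∧even-b⇒Γ2 {M · V} (Γ₀2-· {M} {V} pM V∈Γ₀2) 2∣b′)
  where
  odd+odd : ∀ p q → (+ 1 + p * + 2) * + 1 + (+ 1 + q * + 2) * + 1 ≡ (+ 1 + p + q) * + 2
  odd+odd = solve-∀
  2∣b′ : Even (b (M · V))
  2∣b′ = ℤ∣ˢ.∣⇒∣ᵤ {+ 2} {b (M · V)}
           (ℤ∣ˢ.divides (+ 1 + p + q) (trans (cong₂ (λ x y → x * + 1 + y * + 1) a≡ b≡) (odd+odd p q)))

powℕ-involution : ∀ {g} → g · g ≈P I → ∀ k → powℕ g k ≈P I ⊎ powℕ g k ≈P g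
powℕ-involution gg zero = inj₁ ≈P-refl
powℕ-involution {g} gg (suc k) with powℕ-involution gg k
... | inj₁ gᵏ≈I = inj₂ (≈P-trans (·-congˡ-≈P g gᵏ≈I) (inj₁ (·-identityʳ g)))
... | inj₂ gᵏ≈g = inj₁ (≈P-trans (·-congˡ-≈P g gᵏ≈g) gg)

-- V · V and inv V compute to neg I and neg V.
pow-V : ∀ k → pow V k ≈P I ⊎ pow V k ≈P V
pow-V (+ k) = powℕ-involution (inj₂ refl) k
pow-V -[1+ k ] = Sum.map₂ (λ ≈V⁻¹ → ≈P-trans ≈V⁻¹ (inj₂ refl))
                               (powℕ-involution {inv V} (inj₂ refl) (suc k))

∣m-2n∣<m : ∀ {m n} → 0 < n → n < m → ∣ + m - + 2 * + n ∣ < m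
∣m-2n∣<m {m} {n} 0<n n<m rewrite sym (ℤₚ.pos-* 2 n) | ℤₚ.m-n≡m⊖n m (2 ℕ.* n) with 2 ℕ.* n ℕ.≤? m
... | yes 2n≤m rewrite ℤₚ.∣m⊖n∣≡∣n⊖m∣ m (2 ℕ.* n) | ℤₚ.∣⊖∣-≤ 2n≤m =
  ℕₚ.∸-monoʳ-< (ℕₚ.<-≤-trans 0<n (ℕₚ.m≤m+n n _)) 2n≤m
... | no 2n≰m rewrite ℤₚ.∣⊖∣-≰ 2n≰m =
  ℕₚ.m<n+o⇒m∸n<o (2 ℕ.* n) m {{ℕ.>-nonZero (ℕₚ.<-trans 0<n n<m)}}
    (subst (λ k → 2 ℕ.* n < m ℕ.+ k) (ℕₚ.+-identityʳ m) (ℕₚ.+-mono-< n<m (ℕₚ.+-monoˡ-< 0 n<m)))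

euclid-step⁺ : ∀ m y → 0 < ∣ y ∣ → ∣ y ∣ < m → ∣ + m - + 2 * y ∣ < m ⊎ ∣ + m + + 2 * y ∣ < m
euclid-step⁺ m (+ n) 0<n n<m = inj₁ (∣m-2n∣<m 0<n n<m)
euclid-step⁺ m y@(-[1+ n ]) 0<n n<m =
  inj₂ (subst (λ z → ∣ z ∣ < m) (identity (+ m) y) (∣m-2n∣<m 0<n n<m))
  where
  identity : ∀ x y → x - + 2 * (- y) ≡ x + + 2 * y
  identity = solve-∀

euclid-step : ∀ x y → 0 < ∣ y ∣ → ∣ y ∣ < ∣ x ∣ → ∣ x - + 2 * y ∣ < ∣ x ∣ ⊎ ∣ x + + 2 * y ∣ < ∣ x ∣
euclid-step (+ m) = euclid-step⁺ m
euclid-step x@(-[1+ m ]) y 0<∣y∣ ∣y∣<∣x∣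
  with euclid-step⁺ (suc m) (- y) (subst (0 <_) (sym (ℤₚ.∣-i∣≡∣i∣ y)) 0<∣y∣)
                                  (subst (_< ∣ x ∣) (sym (ℤₚ.∣-i∣≡∣i∣ y)) ∣y∣<∣x∣)
... | inj₁ r = inj₁ (subst (_< ∣ x ∣) (trans (cong ∣_∣ (identity₁ x y)) (ℤₚ.∣-i∣≡∣i∣ (x - + 2 * y))) r)
  where
  identity₁ : ∀ x y → - x - + 2 * (- y) ≡ - (x - + 2 * y)
  identity₁ = solve-∀
... | inj₂ r = inj₂ (subst (_< ∣ x ∣) (trans (cong ∣_∣ (identity₂ x y)) (ℤₚ.∣-i∣≡∣i∣ (x + + 2 * y))) r)
  where
  identity₂ : ∀ x y → - x + + 2 * (- y) ≡ - (x + + 2 * y)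
  identity₂ = solve-∀

data Generator : Mat → Set where
  T²  : Generator (T · T)
  T⁻² : Generator (inv (T · T))
  U¹  : Generator U
  U⁻¹ : Generator (inv U)

Generator⇒Γ2 : ∀ {g} → Generator g → Γ2 g
Generator⇒Γ2 T²  = refl , ℕ∣.divides 1 refl , ℕ∣.divides 0 refl
Generator⇒Γ2 T⁻² = refl , ℕ∣.divides 1 refl , ℕ∣.divides 0 refl
Generator⇒Γ2 U¹  = refl , ℕ∣.divides 0 refl , ℕ∣.divides 1 refl
Generator⇒Γ2 U⁻¹ = refl , ℕ∣.divides 0 refl , ℕ∣.divides 1 refl

infixr 5 _∷_

data Word : Mat → Set where
  []  : Word I
  _∷_ : ∀ {g W} → Generator g → Word W → Word (g · W)

Word⇒Γ2 : ∀ {W} → Word W → Γ2 W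
Word⇒Γ2 [] = Γ2-I
Word⇒Γ2 (_∷_ {g} {W} gen w) = Γ2-· {g} {W} (Generator⇒Γ2 gen) (Word⇒Γ2 w)

T²-pow : ℤ → Mat
T²-pow q = mat (+ 1) (q * + 2) (+ 0) (+ 1)

T²-pow-word : ∀ q → Word (T²-pow q)
T²-pow-word (+ zero) = []
T²-pow-word (+ suc k) = subst Word (mat-cong refl (step (+ k)) refl refl) (T² ∷ T²-pow-word (+ k))
  where
  step : ∀ q → + 1 * (q * + 2) + + 2 * + 1 ≡ (+ 1 + q) * + 2
  step = solve-∀
T²-pow-word -[1+ zero ] = T⁻² ∷ []
T²-pow-word -[1+ suc k ] =
  subst Word (mat-cong refl (step -[1+ k ]) refl refl) (T⁻² ∷ T²-pow-word -[1+ k ])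
  where
  step : ∀ q → + 1 * (q * + 2) + - + 2 * + 1 ≡ (-[1+ 0 ] + q) * + 2
  step = solve-∀

∣i∣≡1⇒i≡±1 : ∀ {i} → ∣ i ∣ ≡ 1 → i ≡ + 1 ⊎ i ≡ -[1+ 0 ]
∣i∣≡1⇒i≡±1 {+ 1} _ = inj₁ refl
∣i∣≡1⇒i≡±1 { -[1+ 0 ]} _ = inj₂ refl
∣i∣≡1⇒i≡±1 {+ 0} ()
∣i∣≡1⇒i≡±1 {+ suc (suc _)} ()
∣i∣≡1⇒i≡±1 { -[1+ suc _ ]} ()

i*j≡1⇒i≡j≡±1 : ∀ {i j} → i * j ≡ + 1 → (i ≡ + 1 × j ≡ + 1) ⊎ (i ≡ -[1+ 0 ] × j ≡ -[1+ 0 ])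
i*j≡1⇒i≡j≡±1 {i} {j} ij≡1 with ∣i∣≡1⇒i≡±1 {i} (ℕₚ.m*n≡1⇒m≡1 ∣ i ∣ ∣ j ∣ ∣i∣∣j∣≡1)
                          | ∣i∣≡1⇒i≡±1 {j} (ℕₚ.m*n≡1⇒n≡1 ∣ i ∣ ∣ j ∣ ∣i∣∣j∣≡1)
  where
  ∣i∣∣j∣≡1 : ∣ i ∣ ℕ.* ∣ j ∣ ≡ 1
  ∣i∣∣j∣≡1 = trans (sym (ℤₚ.abs-* i j)) (cong ∣_∣ ij≡1)
i*j≡1⇒i≡j≡±1 _  | inj₁ refl | inj₁ refl = inj₁ (refl , refl)
i*j≡1⇒i≡j≡±1 _  | inj₂ refl | inj₂ refl = inj₂ (refl , refl)
i*j≡1⇒i≡j≡±1 () | inj₁ refl | inj₂ refl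
i*j≡1⇒i≡j≡±1 () | inj₂ refl | inj₁ refl

upper-triangular⇒word : ∀ {x y z} → Γ2 (mat x y (+ 0) z) → ∃ λ W → Word W × mat x y (+ 0) z ≈P W
upper-triangular⇒word {x} {y} {z} (det≡1 , 2∣y , _)
  with ℤ∣ˢ.∣ᵤ⇒∣ {+ 2} {y} 2∣y | i*j≡1⇒i≡j≡±1 {x} {z} (trans (sym (det-diagonal x y z)) det≡1)
  where
  det-diagonal : ∀ x y z → x * z - y * + 0 ≡ x * z
  det-diagonal = solve-∀
... | ℤ∣ˢ.divides q refl | inj₁ (refl , refl) = T²-pow q , T²-pow-word q , ≈P-refl
... | ℤ∣ˢ.divides q refl | inj₂ (refl , refl) =
  T²-pow (- q) , T²-pow-word (- q) , inj₂ (mat-cong refl (identity q) refl refl)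
  where
  identity : ∀ q → q * + 2 ≡ - (- q * + 2)
  identity = solve-∀

μ : Mat → ℕ
μ M = ∣ a M ∣ ℕ.+ ∣ c M ∣

μ-cong : ∀ {M x y} → a M ≡ x → c M ≡ y → μ M ≡ ∣ x ∣ ℕ.+ ∣ y ∣
μ-cong refl refl = refl

μ-T² : ∀ x y z w → μ (inv (T · T) · mat x y z w) ≡ ∣ x - + 2 * z ∣ ℕ.+ ∣ z ∣
μ-T² x y z w = μ-cong {inv (T · T) · mat x y z w} (e₁ x z) (e₂ x z)
  where
  e₁ : ∀ x z → + 1 * x + - + 2 * z ≡ x - + 2 * z
  e₁ = solve-∀
  e₂ : ∀ x z → - + 0 * x + + 1 * z ≡ z
  e₂ = solve-∀

μ-T⁻² : ∀ x y z w → μ (inv (inv (T · T)) · mat x y z w) ≡ ∣ x + + 2 * z ∣ ℕ.+ ∣ z ∣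
μ-T⁻² x y z w = μ-cong {inv (inv (T · T)) · mat x y z w} (e₁ x z) (e₂ x z)
  where
  e₁ : ∀ x z → + 1 * x + + 2 * z ≡ x + + 2 * z
  e₁ = solve-∀
  e₂ : ∀ x z → + 0 * x + + 1 * z ≡ z
  e₂ = solve-∀

μ-U : ∀ x y z w → μ (inv U · mat x y z w) ≡ ∣ x ∣ ℕ.+ ∣ z - + 2 * x ∣
μ-U x y z w = μ-cong {inv U · mat x y z w} (e₁ x z) (e₂ x z)
  where
  e₁ : ∀ x z → + 1 * x + - + 0 * z ≡ x
  e₁ = solve-∀
  e₂ : ∀ x z → - + 2 * x + + 1 * z ≡ z - + 2 * x
  e₂ = solve-∀

μ-U⁻¹ : ∀ x y z w → μ (inv (inv U) · mat x y z w) ≡ ∣ x ∣ ℕ.+ ∣ z + + 2 * x ∣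
μ-U⁻¹ x y z w = μ-cong {inv (inv U) · mat x y z w} (e₁ x z) (e₂ x z)
  where
  e₁ : ∀ x z → + 1 * x + + 0 * z ≡ x
  e₁ = solve-∀
  e₂ : ∀ x z → + 2 * x + + 1 * z ≡ z + + 2 * x
  e₂ = solve-∀

Γ₀2⇒0<∣a∣ : ∀ {M} → Γ₀2 M → 0 < ∣ a M ∣
Γ₀2⇒0<∣a∣ {M@(mat (+ 0) _ _ _)} pM = ⊥-elim (Γ₀2⇒a-odd {M} pM (ℕ∣.divides 0 refl))
Γ₀2⇒0<∣a∣ {mat (+ suc _) _ _ _} _ = s≤s z≤n
Γ₀2⇒0<∣a∣ {mat -[1+ _ ] _ _ _} _ = s≤s z≤n

descent-step : ∀ {M} → Γ2 M → 0 < ∣ c M ∣ → ∃ λ g → Generator g × μ (inv g · M) < μ M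
descent-step {M@(mat x y z w)} pM 0<∣z∣ with ℕₚ.<-cmp ∣ z ∣ ∣ x ∣
... | tri< ∣z∣<∣x∣ _ _ with euclid-step x z 0<∣z∣ ∣z∣<∣x∣
...   | inj₁ r = _ , T²  , subst (_< μ M) (sym (μ-T² x y z w)) (ℕₚ.+-monoˡ-< ∣ z ∣ r)
...   | inj₂ r = _ , T⁻² , subst (_< μ M) (sym (μ-T⁻² x y z w)) (ℕₚ.+-monoˡ-< ∣ z ∣ r)
descent-step {M@(mat x y z w)} pM 0<∣z∣ | tri> _ _ ∣x∣<∣z∣
  with euclid-step z x (Γ₀2⇒0<∣a∣ {M} (Γ2⇒Γ₀2 {M} pM)) ∣x∣<∣z∣
...   | inj₁ r = _ , U¹  , subst (_< μ M) (sym (μ-U x y z w)) (ℕₚ.+-monoʳ-< ∣ x ∣ r)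
...   | inj₂ r = _ , U⁻¹ , subst (_< μ M) (sym (μ-U⁻¹ x y z w)) (ℕₚ.+-monoʳ-< ∣ x ∣ r)
descent-step {M@(mat x y z w)} pM@(_ , _ , 2∣z) _ | tri≈ _ ∣z∣≡∣x∣ _ =
  ⊥-elim (Γ₀2⇒a-odd {M} (Γ2⇒Γ₀2 {M} pM) (subst (2 ℕ∣.∣_) ∣z∣≡∣x∣ 2∣z))

Γ2⇒word : ∀ {M} → Γ2 M → ∃ λ W → Word W × M ≈P W
Γ2⇒word {M} pM = bounded (suc (μ M)) pM (ℕₚ.n<1+n (μ M))
  where
  bounded : ∀ n {M} → Γ2 M → μ M < n → ∃ λ W → Word W × M ≈P W
  descend : ∀ n {M} → Γ2 M → 0 < ∣ c M ∣ → μ M < suc n → ∃ λ W → Word W × M ≈P W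

  bounded (suc n) {mat _ _ (+ 0) _} pM _ = upper-triangular⇒word pM
  bounded (suc n) {mat _ _ (+ suc _) _} pM μ<1+n = descend n pM (s≤s z≤n) μ<1+n
  bounded (suc n) {mat _ _ -[1+ _ ] _} pM μ<1+n = descend n pM (s≤s z≤n) μ<1+n

  descend n {M} pM 0<∣c∣ μ<1+n with descent-step {M} pM 0<∣c∣
  ... | g , gen , μ′<μ
    with bounded n (Γ2-· {inv g} {M} (Γ2-inv {g} (Generator⇒Γ2 gen)) pM)
                   (ℕₚ.<-≤-trans μ′<μ (ℕ.s≤s⁻¹ μ<1+n))
  ... | W , w , M′≈W = g · W , gen ∷ w ,
    ≈P-trans (inj₁ (sym (·-inv-cancelˡ {g} (proj₁ (Generator⇒Γ2 gen)) M))) (·-congˡ-≈P g M′≈W)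

·V·V≈P : ∀ M → (M · V) · pow V (+ 1) ≈P M
·V·V≈P M = inj₂ (begin
  (M · V) · (V · I)  ≡⟨ ·-assoc M V (V · I) ⟩
  M · neg I          ≡⟨ ·-neg M I ⟩
  neg (M · I)        ≡⟨ cong neg (·-identityʳ M) ⟩
  neg M              ∎)
  where open ≡-Reasoning

index-Join-V : ∀ {ℓ} {K : Mat → Set ℓ} {m} → (∀ {M} → K M → Γ2 M) → (∀ {M N} → M ≈P N → K N → K M) →
               Index Γ2 K m → Index Γ₀2 (Join K V) m
index-Join-V {K = K} K⇒Γ2 K-resp ix = record
  { rep = rep ; rep∈G = λ i → Γ2⇒Γ₀2 {rep i} (rep∈G i) ; distinct = distinctV ; cover = coverV }
  where
  open Index ix

  distinctV : ∀ i j → Join K V (inv (rep i) · rep j) → i ≡ j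
  distinctV i j (h , k , Kh , N≈hVᵏ) with pow-V k
  ... | inj₁ Vᵏ≈I =
    distinct i j (K-resp (≈P-trans N≈hVᵏ (≈P-trans (·-congˡ-≈P h Vᵏ≈I) (inj₁ (·-identityʳ h)))) Kh)
  ... | inj₂ Vᵏ≈V = ⊥-elim (V∉Γ2 (Γ2-≈P V≈h⁻¹N (Γ2-· {inv h} {N} (Γ2-inv {h} (K⇒Γ2 Kh)) pN)))
    where
    N = inv (rep i) · rep j
    pN = Γ2-· {inv (rep i)} {rep j} (Γ2-inv {rep i} (rep∈G i)) (rep∈G j)
    V≈h⁻¹N : V ≈P inv h · N
    V≈h⁻¹N = ≈P-trans (inj₁ (sym (inv-·-cancelˡ {h} (proj₁ (K⇒Γ2 Kh)) V)))
                      (·-congˡ-≈P (inv h) (≈P-sym (≈P-trans N≈hVᵏ (·-congˡ-≈P h Vᵏ≈V))))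

  coverV : ∀ x → Γ₀2 x → ∃ λ i → Join K V (inv (rep i) · x)
  coverV x px with Γ₀2⇒Γ2⊎Γ2·V {x} px
  ... | inj₁ px′ with cover x px′
  ...   | i , Kh = i , (inv (rep i) · x , + 0 , Kh , inj₁ (sym (·-identityʳ _)))
  coverV x px | inj₂ pxV with cover (x · V) pxV
  ...   | i , Kh = i , (inv (rep i) · (x · V) , + 1 , Kh ,
                        ≈P-sym (subst (λ Z → Z · pow V (+ 1) ≈P inv (rep i) · x)
                                      (·-assoc (inv (rep i)) x V) (·V·V≈P (inv (rep i) · x))))

module Powers {c ℓ} (A : AbelianGroup c ℓ) where
  open AbelianGroup A
    renaming (Carrier to ∣A∣; refl to ≈-refl; sym to ≈-sym; trans to ≈-trans)
  open import Relation.Binary.Reasoning.Setoid setoid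
  open import Algebra.Properties.Monoid.Mult monoid
    using (×-congʳ; ×-homo-+; ×-assocˡ) renaming (_×_ to _×ᴹ_)
  open import Algebra.Properties.Group group using (inverseʳ-unique)

  infixr 8 _^_
  _^_ : ∣A∣ → ℕ → ∣A∣
  x ^ k = k ×ᴹ x

  powA≡^ : ∀ x k → powA A x k ≡ x ^ k
  powA≡^ x zero = refl
  powA≡^ x (suc k) = cong (x ∙_) (powA≡^ x k)

  ^-congˡ : ∀ k {x y} → x ≈ y → x ^ k ≈ y ^ k
  ^-congˡ = ×-congʳ

  ^-homo-+ : ∀ x m n → x ^ (m ℕ.+ n) ≈ x ^ m ∙ x ^ n
  ^-homo-+ = ×-homo-+

  ^-^ : ∀ x m n → (x ^ n) ^ m ≈ x ^ (m ℕ.* n)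
  ^-^ = ×-assocˡ

  ε^ : ∀ k → ε ^ k ≈ ε
  ε^ zero = ≈-refl
  ε^ (suc k) = ≈-trans (identityˡ _) (ε^ k)

  infix 4 _∈⟨_⟩
  _∈⟨_⟩ : ∣A∣ → ∣A∣ → Set ℓ
  x ∈⟨ y ⟩ = ∃ λ t → x ≈ y ^ t

  ≈⇒∈⟨⟩ : ∀ {x y} → x ≈ y → x ∈⟨ y ⟩
  ≈⇒∈⟨⟩ x≈y = 1 , ≈-trans x≈y (≈-sym (identityʳ _))

  ∈⟨⟩-resp : ∀ {x x′ y} → x ≈ x′ → x ∈⟨ y ⟩ → x′ ∈⟨ y ⟩
  ∈⟨⟩-resp x≈x′ (t , x≈yᵗ) = t , ≈-trans (≈-sym x≈x′) x≈yᵗ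

  ∈⟨⟩-trans : ∀ {x y z} → x ∈⟨ y ⟩ → y ∈⟨ z ⟩ → x ∈⟨ z ⟩
  ∈⟨⟩-trans {x} {y} {z} (t , x≈yᵗ) (s , y≈zˢ) = t ℕ.* s , (begin
    x            ≈⟨ x≈yᵗ ⟩
    y ^ t        ≈⟨ ^-congˡ t y≈zˢ ⟩
    (z ^ s) ^ t  ≈⟨ ^-^ z t s ⟩
    z ^ (t ℕ.* s) ∎)

  ε∈⟨⟩ : ∀ {y} → ε ∈⟨ y ⟩
  ε∈⟨⟩ = 0 , ≈-refl

  ∈⟨⟩-∙ : ∀ {x x′ y} → x ∈⟨ y ⟩ → x′ ∈⟨ y ⟩ → x ∙ x′ ∈⟨ y ⟩
  ∈⟨⟩-∙ {y = y} (t , x≈yᵗ) (t′ , x′≈yᵗ′) =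
    t ℕ.+ t′ , ≈-trans (∙-cong x≈yᵗ x′≈yᵗ′) (≈-sym (^-homo-+ y t t′))

  ∈⟨ε⟩ : ∀ {x} → x ∈⟨ ε ⟩ → x ≈ ε
  ∈⟨ε⟩ (t , x≈εᵗ) = ≈-trans x≈εᵗ (ε^ t)

  ∈⟨⟩-order : ∀ {x y} m → y ^ m ≈ ε → x ∈⟨ y ⟩ → x ^ m ≈ ε
  ∈⟨⟩-order {x} {y} m yᵐ≈ε (t , x≈yᵗ) = begin
    x ^ m          ≈⟨ ^-congˡ m x≈yᵗ ⟩
    (y ^ t) ^ m    ≈⟨ ^-^ y m t ⟩
    y ^ (m ℕ.* t)  ≡⟨ cong (y ^_) (ℕₚ.*-comm m t) ⟩
    y ^ (t ℕ.* m)  ≈⟨ ^-^ y t m ⟨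
    (y ^ m) ^ t    ≈⟨ ^-congˡ t yᵐ≈ε ⟩
    ε ^ t          ≈⟨ ε^ t ⟩
    ε              ∎

  ⁻¹≈^ : ∀ {x} m → x ^ suc m ≈ ε → x ⁻¹ ≈ x ^ m
  ⁻¹≈^ {x} m order = ≈-sym (inverseʳ-unique x (x ^ m) order)

  ∈⟨⟩-⁻¹ : ∀ {x y} m → y ^ suc m ≈ ε → x ∈⟨ y ⟩ → x ⁻¹ ∈⟨ y ⟩
  ∈⟨⟩-⁻¹ m order x∈⟨y⟩ = ∈⟨⟩-trans (m , ⁻¹≈^ m (∈⟨⟩-order (suc m) order x∈⟨y⟩)) x∈⟨y⟩

module PrimitiveRoot {c ℓ} (A : AbelianGroup c ℓ) {ζ : AbelianGroup.Carrier A} (n₀ : ℕ)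
                     (ζ-primitive : IsPrimitiveRoot A ζ (suc n₀)) where
  open AbelianGroup A
    renaming (Carrier to ∣A∣; refl to ≈-refl; sym to ≈-sym; trans to ≈-trans)
  open Powers A
  open import Algebra.Properties.AbelianGroup A using (∙-cancelˡ)
  open import Relation.Binary.Reasoning.Setoid setoid

  n : ℕ
  n = suc n₀

  ζⁿ≈ε : ζ ^ n ≈ ε
  ζⁿ≈ε = ≈-trans (reflexive (sym (powA≡^ ζ n))) (proj₁ (proj₂ ζ-primitive))

  ζᵏ≉ε : ∀ {k} → 0 < k → k < n → ¬ ζ ^ k ≈ ε
  ζᵏ≉ε {k} 0<k k<n ζᵏ≈ε = proj₂ (proj₂ ζ-primitive) k 0<k k<n (≈-trans (reflexive (powA≡^ ζ k)) ζᵏ≈ε)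

  ζ^-%n : ∀ m → ζ ^ m ≈ ζ ^ (m % n)
  ζ^-%n m = begin
    ζ ^ m                            ≡⟨ cong (ζ ^_) (m≡m%n+[m/n]*n m n) ⟩
    ζ ^ (m % n ℕ.+ (m / n) ℕ.* n)    ≈⟨ ^-homo-+ ζ (m % n) ((m / n) ℕ.* n) ⟩
    ζ ^ (m % n) ∙ ζ ^ ((m / n) ℕ.* n) ≈⟨ ∙-congˡ (^-^ ζ (m / n) n) ⟨
    ζ ^ (m % n) ∙ (ζ ^ n) ^ (m / n)  ≈⟨ ∙-congˡ (^-congˡ (m / n) ζⁿ≈ε) ⟩
    ζ ^ (m % n) ∙ ε ^ (m / n)        ≈⟨ ∙-congˡ (ε^ (m / n)) ⟩
    ζ ^ (m % n) ∙ ε                  ≈⟨ identityʳ _ ⟩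
    ζ ^ (m % n)                      ∎

  ζ^-injective-≤ : ∀ {i j} → i ≤ j → j < n → ζ ^ i ≈ ζ ^ j → i ≡ j
  ζ^-injective-≤ {i} {j} i≤j j<n ζⁱ≈ζʲ with ℕₚ.m≤n⇒∃[o]m+o≡n i≤j
  ... | zero , i+0≡j = trans (sym (ℕₚ.+-identityʳ i)) i+0≡j
  ... | suc k , refl = ⊥-elim (ζᵏ≉ε (s≤s z≤n) (ℕₚ.≤-<-trans (ℕₚ.m≤n+m (suc k) i) j<n) ζᵏ≈ε)
    where
    ζᵏ≈ε : ζ ^ suc k ≈ ε
    ζᵏ≈ε = ≈-sym (∙-cancelˡ (ζ ^ i) ε (ζ ^ suc k) (begin
      ζ ^ i ∙ ε              ≈⟨ identityʳ _ ⟩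
      ζ ^ i                  ≈⟨ ζⁱ≈ζʲ ⟩
      ζ ^ (i ℕ.+ suc k)      ≈⟨ ^-homo-+ ζ i (suc k) ⟩
      ζ ^ i ∙ ζ ^ suc k      ∎))

  ζ^-injective : ∀ {i j} → i < n → j < n → ζ ^ i ≈ ζ ^ j → i ≡ j
  ζ^-injective {i} {j} i<n j<n ζⁱ≈ζʲ with ℕₚ.≤-total i j
  ... | inj₁ i≤j = ζ^-injective-≤ i≤j j<n ζⁱ≈ζʲ
  ... | inj₂ j≤i = sym (ζ^-injective-≤ j≤i i<n (≈-sym ζⁱ≈ζʲ))

  ζ^≈ζ^⇒%≡ : ∀ {i j} d .{{_ : NonZero d}} → d ∣ n → ζ ^ i ≈ ζ ^ j → i % d ≡ j % d
  ζ^≈ζ^⇒%≡ {i} {j} d d∣n ζⁱ≈ζʲ =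
    trans (sym (m∣n⇒o%n%m≡o%m d n i d∣n)) (trans (cong (_% d) i%n≡j%n) (m∣n⇒o%n%m≡o%m d n j d∣n))
    where
    i%n≡j%n : i % n ≡ j % n
    i%n≡j%n = ζ^-injective (m%n<n i n) (m%n<n j n) (≈-trans (≈-sym (ζ^-%n i)) (≈-trans ζⁱ≈ζʲ (ζ^-%n j)))

module Characters {c ℓ} (A : AbelianGroup c ℓ) (X : Character A) where
  open AbelianGroup A
    renaming (Carrier to ∣A∣; refl to ≈-refl; sym to ≈-sym; trans to ≈-trans)
  open Character X
  open Powers A
  open import Algebra.Properties.AbelianGroup A using (identityˡ-unique; inverseˡ-unique; x≈y⇒x∙y⁻¹≈ε)
  open import Relation.Binary.Reasoning.Setoid setoid

  χ-irrelevant : ∀ {M} (p q : Γ₀2 M) → χ M p ≈ χ M q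
  χ-irrelevant p q = resp p q ≈P-refl

  χ-≡ : ∀ {M N} (p : Γ₀2 M) (q : Γ₀2 N) → M ≡ N → χ M p ≈ χ N q
  χ-≡ p q refl = χ-irrelevant p q

  χ-I : (p : Γ₀2 I) → χ I p ≈ ε
  χ-I p = identityˡ-unique (χ I p) (χ I p) (≈-sym (hom p p p))

  χ-inv : ∀ {M} (p : Γ₀2 M) (q : Γ₀2 (inv M)) → χ (inv M) q ≈ χ M p ⁻¹
  χ-inv {M} p q = inverseˡ-unique _ _ (begin
    χ (inv M) q ∙ χ M p  ≈⟨ hom q p r ⟨
    χ (inv M · M) r      ≈⟨ χ-≡ r Γ₀2-I (inv-inverseˡ {M} (proj₁ p)) ⟩
    χ I Γ₀2-I            ≈⟨ χ-I Γ₀2-I ⟩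
    ε                    ∎)
    where r = Γ₀2-· {inv M} {M} q p

  χ-powℕ : ∀ {g} (p : Γ₀2 g) k (q : Γ₀2 (powℕ g k)) → χ (powℕ g k) q ≈ χ g p ^ k
  χ-powℕ p zero q = χ-I q
  χ-powℕ {g} p (suc k) q = ≈-trans (hom p r q) (∙-congˡ (χ-powℕ p k r))
    where r = Γ₀2-powℕ p k

  χ-coset : ∀ {M N} (p : Γ₀2 M) (q : Γ₀2 N) (r : Γ₀2 (inv M · N)) →
            χ N q ≈ χ M p ∙ χ (inv M · N) r
  χ-coset {M} {N} p q r = begin
    χ N q                  ≈⟨ χ-≡ q s (sym (·-inv-cancelˡ {M} (proj₁ p) N)) ⟩
    χ (M · (inv M · N)) s  ≈⟨ hom p r s ⟩
    χ M p ∙ χ (inv M · N) r ∎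
    where s = Γ₀2-· {M} {inv M · N} p r

  H0-resp-≈P : ∀ {M N} → M ≈P N → H0 A X N → H0 A X M
  H0-resp-≈P {M} {N} M≈N (pN , χN≈ε) =
    Γ2-≈P M≈N pN , ≈-trans (resp _ (Γ2⇒Γ₀2 {N} pN) M≈N) χN≈ε

  -- The order hypothesis keeps ⟨ χ g ⟩, defined through ℕ-powers, closed under inverses,
  -- so negative powers of g are covered as well.
  Join-H0⇔ : ∀ {g} (pg : Γ2 g) m → χ g (Γ2⇒Γ₀2 {g} pg) ^ suc m ≈ ε → ∀ M →
             Join (H0 A X) g M ⇔ Σ (Γ2 M) λ pM → χ M (Γ2⇒Γ₀2 {M} pM) ∈⟨ χ g (Γ2⇒Γ₀2 {g} pg) ⟩
  Join-H0⇔ {g} pg m order M = mk⇔ to from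
    where
    qg = Γ2⇒Γ₀2 {g} pg
    y = χ g qg

    χ-pow : ∀ k (q : Γ₀2 (pow g k)) → χ (pow g k) q ∈⟨ y ⟩
    χ-pow (+ t) q = t , χ-powℕ qg t q
    χ-pow -[1+ t ] q =
      ∈⟨⟩-trans (suc t , χ-powℕ qg⁻¹ (suc t) q)
                (∈⟨⟩-resp (≈-sym (χ-inv qg qg⁻¹)) (∈⟨⟩-⁻¹ m order (≈⇒∈⟨⟩ ≈-refl)))
      where qg⁻¹ = Γ₀2-inv {g} qg

    to : Join (H0 A X) g M → Σ (Γ2 M) λ pM → χ M (Γ2⇒Γ₀2 {M} pM) ∈⟨ y ⟩
    to (h , k , (ph , χh≈ε) , M≈hgᵏ) = pM , ∈⟨⟩-resp (≈-sym χM≈χgᵏ) (χ-pow k qgᵏ)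
      where
      qh = Γ2⇒Γ₀2 {h} ph
      qgᵏ = Γ2⇒Γ₀2 {pow g k} (Γ2-pow pg k)
      qhgᵏ = Γ₀2-· {h} {pow g k} qh qgᵏ
      pM = Γ2-≈P M≈hgᵏ (Γ2-· {h} {pow g k} ph (Γ2-pow pg k))
      χM≈χgᵏ : χ M (Γ2⇒Γ₀2 {M} pM) ≈ χ (pow g k) qgᵏ
      χM≈χgᵏ = begin
        χ M (Γ2⇒Γ₀2 {M} pM)         ≈⟨ resp _ qhgᵏ M≈hgᵏ ⟩
        χ (h · pow g k) qhgᵏ        ≈⟨ hom qh qgᵏ qhgᵏ ⟩
        χ h qh ∙ χ (pow g k) qgᵏ    ≈⟨ ∙-congʳ χh≈ε ⟩
        ε ∙ χ (pow g k) qgᵏ         ≈⟨ identityˡ _ ⟩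
        χ (pow g k) qgᵏ             ∎

    from : (Σ (Γ2 M) λ pM → χ M (Γ2⇒Γ₀2 {M} pM) ∈⟨ y ⟩) → Join (H0 A X) g M
    from (pM , t , χM≈yᵗ) = M · inv G , + t , (ph , χh≈ε) , inj₁ (sym (inv-·-cancelʳ {G} (proj₁ pG) M))
      where
      G = powℕ g t
      pG = Γ2-powℕ pg t
      qG = Γ2⇒Γ₀2 {G} pG
      qG⁻¹ = Γ₀2-inv {G} qG
      qM = Γ2⇒Γ₀2 {M} pM
      ph = Γ2-· {M} {inv G} pM (Γ2-inv {G} pG)
      χh≈ε : χ (M · inv G) (Γ2⇒Γ₀2 {M · inv G} ph) ≈ ε
      χh≈ε = begin
        χ (M · inv G) _          ≈⟨ hom qM qG⁻¹ _ ⟩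
        χ M qM ∙ χ (inv G) qG⁻¹  ≈⟨ ∙-congˡ (χ-inv qG qG⁻¹) ⟩
        χ M qM ∙ χ G qG ⁻¹       ≈⟨ x≈y⇒x∙y⁻¹≈ε (≈-trans χM≈yᵗ (≈-sym (χ-powℕ qg t qG))) ⟩
        ε                        ∎

module Lemma3p3 {c ℓ} (A : AbelianGroup c ℓ) (X : Character A) (n₀ : ℕ)
                (ζ-primitive : IsPrimitiveRoot A (Character.χ X U U∈Γ₀2) (suc n₀)) where
  open AbelianGroup A
    renaming (Carrier to ∣A∣; refl to ≈-refl; sym to ≈-sym; trans to ≈-trans)
  open Character X
  open Powers A
  open Characters A X
  open PrimitiveRoot A n₀ ζ-primitive
  open import Algebra.Properties.AbelianGroup A using (∙-cancelˡ; xyx⁻¹≈y)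
  open import Algebra.Properties.CommutativeSemigroup commutativeSemigroup using (interchange)
  open import Relation.Binary.Reasoning.Setoid setoid

  ζ : ∣A∣
  ζ = χ U U∈Γ₀2

  T∈Γ₀2 : Γ₀2 T
  T∈Γ₀2 = refl , ℕ∣.divides 0 refl

  χ-V² : χ V V∈Γ₀2 ∙ χ V V∈Γ₀2 ≈ ε
  χ-V² = begin
    χ V V∈Γ₀2 ∙ χ V V∈Γ₀2  ≈⟨ hom V∈Γ₀2 V∈Γ₀2 V²∈Γ₀2 ⟨
    χ (V · V) V²∈Γ₀2       ≈⟨ resp V²∈Γ₀2 Γ₀2-I (inj₂ refl) ⟩
    χ I Γ₀2-I              ≈⟨ χ-I Γ₀2-I ⟩
    ε                      ∎
    where V²∈Γ₀2 = Γ₀2-· {V} {V} V∈Γ₀2 V∈Γ₀2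

  χ-T² : (q : Γ₀2 (T · T)) → χ (T · T) q ≈ ζ ^ 2
  χ-T² q = begin
    χ (T · T) q                ≈⟨ hom T∈Γ₀2 T∈Γ₀2 q ⟩
    χ T T∈Γ₀2 ∙ χ T T∈Γ₀2      ≈⟨ ∙-cong χ-T χ-T ⟩
    (χ V V∈Γ₀2 ∙ ζ) ∙ (χ V V∈Γ₀2 ∙ ζ) ≈⟨ interchange _ _ _ _ ⟩
    (χ V V∈Γ₀2 ∙ χ V V∈Γ₀2) ∙ (ζ ∙ ζ) ≈⟨ ∙-congʳ χ-V² ⟩
    ε ∙ (ζ ∙ ζ)                ≈⟨ identityˡ _ ⟩
    ζ ∙ ζ                      ≈⟨ ∙-congˡ (identityʳ ζ) ⟨
    ζ ^ 2                      ∎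
    where
    χ-T : χ T T∈Γ₀2 ≈ χ V V∈Γ₀2 ∙ ζ
    χ-T = hom V∈Γ₀2 U∈Γ₀2 T∈Γ₀2  -- V · U computes to T

  ⟨ζ⟩-⁻¹ : ∀ {x} → x ∈⟨ ζ ⟩ → x ⁻¹ ∈⟨ ζ ⟩
  ⟨ζ⟩-⁻¹ = ∈⟨⟩-⁻¹ n₀ ζⁿ≈ε

  χ-generator : ∀ {g} → Generator g → (q : Γ₀2 g) → χ g q ∈⟨ ζ ⟩
  χ-generator T²  q = 2 , χ-T² q
  χ-generator T⁻² q = ∈⟨⟩-resp (≈-sym (χ-inv T²∈Γ₀2 q)) (⟨ζ⟩-⁻¹ (2 , χ-T² T²∈Γ₀2))
    where T²∈Γ₀2 = Γ2⇒Γ₀2 {T · T} (Generator⇒Γ2 T²)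
  χ-generator U¹  q = ≈⇒∈⟨⟩ (χ-irrelevant q U∈Γ₀2)
  χ-generator U⁻¹ q = ∈⟨⟩-resp (≈-sym (χ-inv U∈Γ₀2 q)) (⟨ζ⟩-⁻¹ (≈⇒∈⟨⟩ ≈-refl))

  χ-word : ∀ {W} → Word W → (q : Γ₀2 W) → χ W q ∈⟨ ζ ⟩
  χ-word [] q = ∈⟨⟩-resp (≈-sym (χ-I q)) ε∈⟨⟩
  χ-word (_∷_ {g} {W} gen w) q =
    ∈⟨⟩-resp (≈-sym (hom qg qW q)) (∈⟨⟩-∙ (χ-generator gen qg) (χ-word w qW))
    where
    qg = Γ2⇒Γ₀2 {g} (Generator⇒Γ2 gen)
    qW = Γ2⇒Γ₀2 {W} (Word⇒Γ2 w)

  χ-Γ2∈⟨ζ⟩ : ∀ {M} → Γ2 M → (q : Γ₀2 M) → χ M q ∈⟨ ζ ⟩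
  χ-Γ2∈⟨ζ⟩ {M} p q with Γ2⇒word p
  ... | W , w , M≈W = ∈⟨⟩-resp (≈-sym (resp q qW M≈W)) (χ-word w qW)
    where qW = Γ2⇒Γ₀2 {W} (Word⇒Γ2 w)

  Γ2⇔Join-H0 : ∀ {g} (pg : Γ2 g) → χ g (Γ2⇒Γ₀2 {g} pg) ≈ ζ → ∀ M → Γ2 M ⇔ Join (H0 A X) g M
  Γ2⇔Join-H0 {g} pg χg≈ζ M = mk⇔
    (λ pM → from (pM , ∈⟨⟩-trans (χ-Γ2∈⟨ζ⟩ {M} pM _) (≈⇒∈⟨⟩ (≈-sym χg≈ζ))))
    (λ j → proj₁ (to j))
    where
    open Equivalence (Join-H0⇔ {g} pg n₀ (≈-trans (^-congˡ n χg≈ζ) ζⁿ≈ε) M)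

  Γ2⇔Join-H0-U : ∀ M → Γ2 M ⇔ Join (H0 A X) U M
  Γ2⇔Join-H0-U = Γ2⇔Join-H0 (Generator⇒Γ2 U¹) (χ-irrelevant _ _)

  Γ2⇔Join-H0-TUT⁻¹ : ∀ M → Γ2 M ⇔ Join (H0 A X) (T · U · inv T) M
  Γ2⇔Join-H0-TUT⁻¹ = Γ2⇔Join-H0 TUT⁻¹∈Γ2 (begin
    χ (T · U · inv T) _                  ≈⟨ hom TU∈Γ₀2 T⁻¹∈Γ₀2 _ ⟩
    χ (T · U) TU∈Γ₀2 ∙ χ (inv T) T⁻¹∈Γ₀2 ≈⟨ ∙-cong (hom T∈Γ₀2 U∈Γ₀2 TU∈Γ₀2) (χ-inv T∈Γ₀2 T⁻¹∈Γ₀2) ⟩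
    χ T T∈Γ₀2 ∙ ζ ∙ χ T T∈Γ₀2 ⁻¹         ≈⟨ xyx⁻¹≈y _ _ ⟩
    ζ                                    ∎)
    where
    TUT⁻¹∈Γ2 : Γ2 (T · U · inv T)
    TUT⁻¹∈Γ2 = refl , ℕ∣.divides 1 refl , ℕ∣.divides 1 refl
    TU∈Γ₀2 = Γ₀2-· {T} {U} T∈Γ₀2 U∈Γ₀2
    T⁻¹∈Γ₀2 = Γ₀2-inv {T} T∈Γ₀2

  index-preimage : ∀ d .{{_ : ℕ.NonZero d}} → d ∣ n → {K : Mat → Set ℓ} →
                   (∀ {M} (p : Γ2 M) → K M ⇔ χ M (Γ2⇒Γ₀2 {M} p) ∈⟨ ζ ^ d ⟩) → Index Γ2 K d
  index-preimage d d∣n {K} K⇔ = record { rep = r ; rep∈G = r∈Γ2 ; distinct = distinct ; cover = cover }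
    where
    r : Fin d → Mat
    r i = powℕ U (toℕ i)

    r∈Γ2 : ∀ i → Γ2 (r i)
    r∈Γ2 i = Γ2-powℕ (Generator⇒Γ2 U¹) (toℕ i)

    r⁻¹·∈Γ2 : ∀ i {x} → Γ2 x → Γ2 (inv (r i) · x)
    r⁻¹·∈Γ2 i {x} px = Γ2-· {inv (r i)} {x} (Γ2-inv {r i} (r∈Γ2 i)) px

    χ-split : ∀ i {x} (qx : Γ₀2 x) (q : Γ₀2 (inv (r i) · x)) → χ x qx ≈ ζ ^ toℕ i ∙ χ (inv (r i) · x) q
    χ-split i qx q = ≈-trans (χ-coset qi qx q) (∙-congʳ (χ-powℕ U∈Γ₀2 (toℕ i) qi))
      where qi = Γ₀2-powℕ U∈Γ₀2 (toℕ i)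

    distinct : ∀ i j → K (inv (r i) · r j) → i ≡ j
    distinct i j Kᵢⱼ = distinct′ (Equivalence.to (K⇔ {inv (r i) · r j} pᵢⱼ) Kᵢⱼ)
      where
      pᵢⱼ = r⁻¹·∈Γ2 i {r j} (r∈Γ2 j)
      qᵢⱼ = Γ2⇒Γ₀2 {inv (r i) · r j} pᵢⱼ
      qj = Γ₀2-powℕ U∈Γ₀2 (toℕ j)
      distinct′ : χ (inv (r i) · r j) qᵢⱼ ∈⟨ ζ ^ d ⟩ → i ≡ j
      distinct′ (t , χᵢⱼ≈) = toℕ-injective
        (trans (sym (m<n⇒m%n≡m (toℕ<n i)))
        (trans (sym ([m+kn]%n≡m%n (toℕ i) t d))
        (trans (sym (ζ^≈ζ^⇒%≡ {toℕ j} {toℕ i ℕ.+ t ℕ.* d} d d∣n ζʲ≈))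
               (m<n⇒m%n≡m (toℕ<n j)))))
        where
        ζʲ≈ : ζ ^ toℕ j ≈ ζ ^ (toℕ i ℕ.+ t ℕ.* d)
        ζʲ≈ = begin
          ζ ^ toℕ j                          ≈⟨ χ-powℕ U∈Γ₀2 (toℕ j) qj ⟨
          χ (r j) qj                         ≈⟨ χ-split i qj qᵢⱼ ⟩
          ζ ^ toℕ i ∙ χ (inv (r i) · r j) qᵢⱼ ≈⟨ ∙-congˡ χᵢⱼ≈ ⟩
          ζ ^ toℕ i ∙ (ζ ^ d) ^ t            ≈⟨ ∙-congˡ (^-^ ζ t d) ⟩
          ζ ^ toℕ i ∙ ζ ^ (t ℕ.* d)          ≈⟨ ^-homo-+ ζ (toℕ i) (t ℕ.* d) ⟨
          ζ ^ (toℕ i ℕ.+ t ℕ.* d)            ∎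

    residue : ℕ → Fin d
    residue m = fromℕ< (m%n<n m d)

    χ-residue : ∀ m {x} (qx : Γ₀2 x) (q : Γ₀2 (inv (r (residue m)) · x)) →
                χ x qx ≈ ζ ^ m → χ (inv (r (residue m)) · x) q ≈ (ζ ^ d) ^ (m / d)
    χ-residue m {x} qx q χx≈ζᵐ = ∙-cancelˡ (ζ ^ toℕ i) _ _ (begin
      ζ ^ toℕ i ∙ χ (inv (r i) · x) q  ≈⟨ χ-split i qx q ⟨
      χ x qx                           ≈⟨ χx≈ζᵐ ⟩
      ζ ^ m                            ≡⟨ cong (ζ ^_) (m≡m%n+[m/n]*n m d) ⟩
      ζ ^ (m % d ℕ.+ m / d ℕ.* d)      ≈⟨ ^-homo-+ ζ (m % d) (m / d ℕ.* d) ⟩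
      ζ ^ (m % d) ∙ ζ ^ (m / d ℕ.* d)  ≡⟨ cong (λ k → ζ ^ k ∙ ζ ^ (m / d ℕ.* d)) (sym (toℕ-fromℕ< m%d<d)) ⟩
      ζ ^ toℕ i ∙ ζ ^ (m / d ℕ.* d)    ≈⟨ ∙-congˡ (^-^ ζ (m / d) d) ⟨
      ζ ^ toℕ i ∙ (ζ ^ d) ^ (m / d)    ∎)
      where
      m%d<d = m%n<n m d
      i = residue m

    cover : ∀ x → Γ2 x → ∃ λ i → K (inv (r i) · x)
    cover x px = cover′ (χ-Γ2∈⟨ζ⟩ {x} px qx)
      where
      qx = Γ2⇒Γ₀2 {x} px
      cover′ : χ x qx ∈⟨ ζ ⟩ → ∃ λ i → K (inv (r i) · x)
      cover′ (m , χx≈ζᵐ) =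
        residue m , Equivalence.from (K⇔ {N} pN) (m / d , χ-residue m qx (Γ2⇒Γ₀2 {N} pN) χx≈ζᵐ)
        where
        N = inv (r (residue m)) · x
        pN = r⁻¹·∈Γ2 (residue m) {x} px

  index-H0 : Index Γ2 (H0 A X) n
  index-H0 = index-preimage n ∣-refl λ {M} p → mk⇔
    (λ (_ , χM≈ε) → 0 , ≈-trans (χ-irrelevant _ _) χM≈ε)
    (λ χM∈⟨ζⁿ⟩ → p , ∈⟨ε⟩ (∈⟨⟩-trans χM∈⟨ζⁿ⟩ (≈⇒∈⟨⟩ ζⁿ≈ε)))

  H0⟨T²⟩ : Mat → Set ℓ
  H0⟨T²⟩ = Join (H0 A X) (T · T)

  H0⟨T²⟩⇔ : ∀ {M} (p : Γ2 M) → H0⟨T²⟩ M ⇔ χ M (Γ2⇒Γ₀2 {M} p) ∈⟨ ζ ^ 2 ⟩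
  H0⟨T²⟩⇔ {M} p = mk⇔
    (λ j → ∈⟨⟩-trans (∈⟨⟩-resp (χ-irrelevant _ _) (proj₂ (to j))) (≈⇒∈⟨⟩ (χ-T² T²∈Γ₀2)))
    (λ χM∈ → from (p , ∈⟨⟩-trans χM∈ (≈⇒∈⟨⟩ (≈-sym (χ-T² T²∈Γ₀2)))))
    where
    T²∈Γ2 = Generator⇒Γ2 T²
    T²∈Γ₀2 = Γ2⇒Γ₀2 {T · T} T²∈Γ2
    open Equivalence (Join-H0⇔ {T · T} T²∈Γ2 n₀ (∈⟨⟩-order n ζⁿ≈ε (2 , χ-T² T²∈Γ₀2)) M)

  ζ∈⟨ζ²⟩ : ¬ 2 ∣ n → ζ ∈⟨ ζ ^ 2 ⟩
  ζ∈⟨ζ²⟩ 2∤n with odd-decomposition n 2∤n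
  ... | h , n≡1+2h = suc h , (begin
    ζ                ≈⟨ identityʳ ζ ⟨
    ζ ∙ ε            ≈⟨ ∙-congˡ ζⁿ≈ε ⟨
    ζ ^ suc n        ≡⟨ cong (λ k → ζ ^ suc k) n≡1+2h ⟩
    ζ ^ (suc h ℕ.* 2) ≈⟨ ^-^ ζ (suc h) 2 ⟨
    (ζ ^ 2) ^ suc h  ∎)

  Γ2⇒H0⟨T²⟩ : ¬ 2 ∣ n → ∀ {M} → Γ2 M → H0⟨T²⟩ M
  Γ2⇒H0⟨T²⟩ 2∤n {M} p = Equivalence.from (H0⟨T²⟩⇔ {M} p) (∈⟨⟩-trans (χ-Γ2∈⟨ζ⟩ {M} p _) (ζ∈⟨ζ²⟩ 2∤n))

  index-H0⟨T²⟩ : (∃ λ m → m ≤ 2 × Index Γ2 H0⟨T²⟩ m) × (Index Γ2 H0⟨T²⟩ 2 ⇔ 2 ∣ n)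
  index-H0⟨T²⟩ with 2 ∣? n
  ... | yes 2∣n = (2 , ℕₚ.≤-refl , index-H0⟨T²⟩-2) , mk⇔ (λ _ → 2∣n) (λ _ → index-H0⟨T²⟩-2)
    where index-H0⟨T²⟩-2 = index-preimage 2 2∣n H0⟨T²⟩⇔
  ... | no 2∤n =
    (1 , s≤s z≤n , index-H0⟨T²⟩-1) , mk⇔ (λ ix → ⊥-elim (¬index-H0⟨T²⟩-2 ix)) (λ 2∣n → ⊥-elim (2∤n 2∣n))
    where
    index-H0⟨T²⟩-1 = index-preimage 1 (1∣ n) λ {M} p →
      mk⇔ (λ _ → ∈⟨⟩-trans (χ-Γ2∈⟨ζ⟩ {M} p _) (≈⇒∈⟨⟩ (≈-sym (identityʳ ζ)))) (λ _ → Γ2⇒H0⟨T²⟩ 2∤n {M} p)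
    ¬index-H0⟨T²⟩-2 : ¬ Index Γ2 H0⟨T²⟩ 2
    ¬index-H0⟨T²⟩-2 ix = 0≢1 (Index.distinct ix Fin.zero (Fin.suc Fin.zero) (Γ2⇒H0⟨T²⟩ 2∤n r₀⁻¹r₁∈Γ2))
      where
      0≢1 : Fin.zero ≡ Fin.suc (Fin.zero {0}) → ⊥
      0≢1 ()
      r₀ = Index.rep ix Fin.zero
      r₁ = Index.rep ix (Fin.suc Fin.zero)
      r₀⁻¹r₁∈Γ2 =
        Γ2-· {inv r₀} {r₁} (Γ2-inv {r₀} (Index.rep∈G ix Fin.zero)) (Index.rep∈G ix (Fin.suc Fin.zero))

lemma3p3 : ∀ {c ℓ : Level} (A : AbelianGroup c ℓ) (X : Character A) (n : ℕ) →
    IsPrimitiveRoot A (Character.χ X U U∈Γ₀2) n →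
    ((Index Γ2 (H0 A X) n × Index Γ₀2 (Join (H0 A X) V) n)
    × ((∀ M → Γ2 M ⇔ Join (H0 A X) U M)
       × (∀ M → Γ2 M ⇔ Join (H0 A X) (T · U · inv T) M))
    × ((∃ λ m → m ≤ 2 × Index Γ2 (Join (H0 A X) (T · T)) m)
       × (Index Γ2 (Join (H0 A X) (T · T)) 2 ⇔ 2 ∣ n)))
lemma3p3 A X zero (() , _)
lemma3p3 A X (suc n₀) ζ-primitive =
    (index-H0 , index-Join-V proj₁ (Characters.H0-resp-≈P A X) index-H0)
  , (Γ2⇔Join-H0-U , Γ2⇔Join-H0-TUT⁻¹)
  , index-H0⟨T²⟩
  where open Lemma3p3 A X n₀ ζ-primitive
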